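{- Let $G$ be a graph, let $x,y$ be two vertices of $G$, and let $F_1,\dots,F_c$ be the components of $G\setminus x\setminus y$. If $\rho^*_G(\{x,y\},V(F_i))=2$ for all $1\le i\le c$, then $G$ has a vertex-minor isomorphic to $K_c\oplus K_c$.
   Context: Graphs are finite and simple. For disjoint $X,Y\subseteq V(G)$, $\rho^*_G(X,Y)$ is the rank over the binary field of the submatrix of the adjacency matrix of $G$ with rows indexed by $X$ and columns by $Y$. $G*v$ is local complementation at $v$ (flip adjacency of every pair of neighbors of $v$); $H$ is a vertex-minor of $G$ if it is an induced subgraph of a graph obtained from $G$ by a sequence of local complementations. $K_c\oplus K_c$ is two disjoint copies of $K_c$ joined by a perfect matching. -}

module Defs where

open import Data.Nat using (ℕ; _≤_)
open import Data.Bool using (Bool; true; false; _∧_; _xor_; if_then_else_; not)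
import Data.Bool as B
open import Data.Fin using (Fin; _≟_)
open import Data.Fin.Subset using (Subset; _∈_; _⊆_; ∣_∣; Nonempty)
open import Data.Vec using (lookup)
open import Data.List using (List; []; _∷_; foldr; allFin)
open import Relation.Nullary using (¬_)
open import Data.Product using (Σ; ∃; _×_; _,_)
open import Relation.Nullary.Decidable using (⌊_⌋)
open import Relation.Binary.PropositionalEquality using (_≡_; _≢_)
open import Function.Definitions using (Injective)

record Graph (n : ℕ) : Set where
  field
    adj    : Fin n → Fin n → Bool
    sym    : ∀ u v → adj u v ≡ adj v u
    irrefl : ∀ u → adj u u ≡ false
open Graph public

Adj : ℕ → Set
Adj n = Fin n → Fin n → Bool

lc : ∀ {n} → Adj n → Fin n → Adj n
lc A v a b = if ⌊ a ≟ b ⌋ then false else (A a b xor (A v a ∧ A v b))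

lcs : ∀ {n} → Adj n → List (Fin n) → Adj n
lcs A []       = A
lcs A (v ∷ vs) = lcs (lc A v) vs

-- G has a vertex-minor isomorphic to H (H a graph on an arbitrary vertex type V):
-- H is isomorphic to an induced subgraph of some G * v1 * ... * vk, i.e. there is an
-- injective map f : V → V(G) with H a b = (G * v1 * ... * vk)(f a, f b).
HasVertexMinorIso : ∀ {n} {V : Set} → Graph n → (V → V → Bool) → Set
HasVertexMinorIso {n} {V} G H =
  Σ (List (Fin n)) λ vs → Σ (V → Fin n) λ f →
    Injective _≡_ _≡_ f × (∀ a b → H a b ≡ lcs (adj G) vs (f a) (f b))

-- K_c ⊕ K_c on vertex set Bool × Fin c: two copies of K_c (b = false / b = true)
-- joined by the perfect matching (false , i) — (true , i).
KK : (c : ℕ) → (Bool × Fin c) → (Bool × Fin c) → Bool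
KK c (a , i) (b , j) = if ⌊ a B.≟ b ⌋ then not ⌊ i ≟ j ⌋ else ⌊ i ≟ j ⌋

data ConnAvoid {n} (G : Graph n) (x y : Fin n) : Fin n → Fin n → Set where
  here : ∀ {u} → u ≢ x → u ≢ y → ConnAvoid G x y u u
  step : ∀ {u v w} → u ≢ x → u ≢ y → adj G u v ≡ true → ConnAvoid G x y v w →
         ConnAvoid G x y u w

-- F : Fin c → Subset n lists the vertex sets of the components F_1..F_c of G \ x \ y
-- (in some order): each is nonempty, they are pairwise disjoint, avoid x and y,
-- cover V(G) \ {x,y}, and each is a connectivity class of G \ x \ y.
IsComponents : ∀ {n c} → Graph n → Fin n → Fin n → (Fin c → Subset n) → Set
IsComponents {n} {c} G x y F =
  (∀ i → Nonempty (F i)) ×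
  (∀ i j u → u ∈ F i → u ∈ F j → i ≡ j) ×
  (∀ i → ¬ (x ∈ F i) × ¬ (y ∈ F i)) ×
  (∀ u → u ≢ x → u ≢ y → ∃ λ i → u ∈ F i) ×
  (∀ i u w → u ∈ F i → (w ∈ F i → ConnAvoid G x y u w) × (ConnAvoid G x y u w → w ∈ F i))

rowSum : ∀ {n} → Adj n → Subset n → Fin n → Bool
rowSum {n} A T j = foldr (λ i acc → (lookup T i ∧ A i j) xor acc) false (allFin n)

-- The rows indexed by S, restricted to the columns Y, are linearly independent over GF(2):
-- every nonempty subset T of S has a nonzero sum on some column in Y.
RowsIndependent : ∀ {n} → Adj n → Subset n → Subset n → Set
RowsIndependent A Y S = ∀ T → T ⊆ S → Nonempty T → ∃ λ j → j ∈ Y × rowSum A T j ≡ true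

-- ρ*_G(X,Y) = k : the GF(2)-rank of the X×Y submatrix of the adjacency matrix is k,
-- i.e. the maximum number of linearly independent rows (indexed by X, restricted to Y) is k.
RankIs : ∀ {n} → Graph n → Subset n → Subset n → ℕ → Set
RankIs G X Y k =
  (Σ _ λ S → S ⊆ X × ∣ S ∣ ≡ k × RowsIndependent (adj G) Y S) ×
  (∀ S → S ⊆ X → RowsIndependent (adj G) Y S → ∣ S ∣ ≤ k)

-- Write σ(v) = (v ~ x , v ~ y) ∈ F₂² for the attachment of a vertex v to x and y.  Rank 2
-- means that each component F_i contains two vertices with linearly independent attachments,
-- and F_i contains a walk between them.  Local complementation at a vertex of attachment 0
-- changes no edge at x or y, and it shortens the walk: if the second vertex v of the walk has
-- attachment 0, complementing at v joins the first vertex to the last neighbour of v on the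
-- walk and keeps the walk after it.  So some edge h s inside F_i has independent attachments; complementing at h adds σ(h) to σ(s), so a few
-- complementations at h and s (a finite check in F₂²) produce an edge a_i b_i with
-- σ(a_i) = (1,0) and σ(b_i) = (x ~ y , 1), without changing x ~ y.  Complementations inside
-- F_i change no entry in the rows of the other components, so this can be done for every
-- component in turn.  Complementing finally at x and y (at y first if x ~ y) complements
-- the edges between a's and between b's and keeps the matching a_i b_i: K_c ⊕ K_c.

module Submission where

open import Data.Bool using (Bool; true; false; not; _∧_; _xor_; if_then_else_)
import Data.Bool as Bool
open import Data.Bool.Properties
  using (∧-comm; ∧-zeroʳ; xor-identityʳ; xor-comm; xor-assoc; ¬-not; not-¬)
open import Data.Empty using (⊥-elim)
open import Data.Fin using (Fin; zero; suc; _≟_)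
open import Data.Fin.Properties using (suc-injective)
open import Data.Fin.Subset using (Subset; _∈_; _∪_; ⁅_⁆; ∣_∣; Nonempty)
open import Data.Fin.Subset.Properties
  using (_∈?_; x∈⁅x⁆; x∈⁅y⁆⇒x≡y; x∈p∪q⁻; ∣⁅x⁆∣≡1; p⊆q⇒∣p∣≤∣q∣)
open import Data.List using (List; []; _∷_; _++_; map; concatMap; foldr; tabulate; allFin)
open import Data.List.Membership.Propositional.Properties using (∈-allFin)
open import Data.List.Relation.Unary.All using (All; []; _∷_; universal)
import Data.List.Relation.Unary.All as All
open import Data.List.Relation.Unary.All.Properties using (map⁺; ++⁺)
open import Data.List.Relation.Unary.AllPairs using (_∷_)
open import Data.List.Relation.Unary.Unique.Propositional using (Unique)
open import Data.List.Relation.Unary.Unique.Propositional.Properties using (allFin⁺)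
open import Data.Nat using (ℕ; zero; suc; _≤_; _<_; s≤s; z≤n)
open import Data.Nat.Induction using (<-wellFounded)
open import Data.Nat.Properties using (<⇒≱; ≤-refl; m≤n⇒m≤1+n)
open import Data.Product using (Σ-syntax; _×_; _,_; proj₁; proj₂; ∃; ∃₂)
open import Data.Product.Properties using (≡-dec)
open import Data.Sum using (_⊎_; inj₁; inj₂; [_,_]′)
import Data.Sum as Sum
open import Data.Vec using (lookup)
open import Data.Vec.Properties using ([]=⇒lookup; lookup⇒[]=)
open import Function using (_∘_)
open import Function.Definitions using (Injective)
open import Induction.WellFounded using (Acc; acc)
open import Relation.Binary.PropositionalEquality
  using (_≡_; _≢_; _≗_; refl; sym; trans; cong; cong₂; subst; subst₂; module ≡-Reasoning)
open import Relation.Nullary using (¬_; Dec; yes; no)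
open import Relation.Nullary.Decidable using (⌊_⌋)

open import Defs renaming (sym to adj-sym)

private
  variable
    n : ℕ

-- Local complementation

lc-≢ : (A : Adj n) (v : Fin n) {a b : Fin n} → a ≢ b →
       lc A v a b ≡ A a b xor (A v a ∧ A v b)
lc-≢ A v {a} {b} a≢b with a ≟ b
... | yes a≡b = ⊥-elim (a≢b a≡b)
... | no _    = refl

lc-diag : (A : Adj n) (v a : Fin n) → lc A v a a ≡ false
lc-diag A v a with a ≟ a
... | yes _  = refl
... | no a≢a = ⊥-elim (a≢a refl)

lc-sym : (G : Graph n) (v a b : Fin n) → lc (adj G) v a b ≡ lc (adj G) v b a
lc-sym G v a b with a ≟ b
... | yes refl = sym (lc-diag (adj G) v a)
... | no a≢b   = begin
  adj G a b xor (adj G v a ∧ adj G v b)              ≡⟨ cong₂ _xor_ (adj-sym G a b) (∧-comm (adj G v a) _) ⟩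
  adj G b a xor (adj G v b ∧ adj G v a)              ≡⟨ lc-≢ (adj G) v (λ b≡a → a≢b (sym b≡a)) ⟨
  lc (adj G) v b a                                   ∎
  where open ≡-Reasoning

_*_ : Graph n → Fin n → Graph n
G * v = record { adj = lc (adj G) v ; sym = lc-sym G v ; irrefl = lc-diag (adj G) v }

_**_ : Graph n → List (Fin n) → Graph n
G ** []       = G
G ** (v ∷ vs) = (G * v) ** vs

infixl 7 _*_ _**_

adj-** : (G : Graph n) (vs : List (Fin n)) → adj (G ** vs) ≡ lcs (adj G) vs
adj-** G []       = refl
adj-** G (v ∷ vs) = adj-** (G * v) vs

**-++ : (G : Graph n) (us vs : List (Fin n)) → G ** (us ++ vs) ≡ G ** us ** vs
**-++ G []       vs = refl
**-++ G (u ∷ us) vs = **-++ (G * u) us vs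

adj-* : (G : Graph n) (v : Fin n) {a b : Fin n} → a ≢ b →
        adj (G * v) a b ≡ adj G a b xor (adj G v a ∧ adj G v b)
adj-* G v = lc-≢ (adj G) v

adj-*-unlinkedˡ : (G : Graph n) {v a : Fin n} (b : Fin n) → adj G v a ≡ false →
                  adj (G * v) a b ≡ adj G a b
adj-*-unlinkedˡ G {v} {a} b va with a ≟ b
... | yes refl = sym (irrefl G a)
... | no _     = trans (cong (λ t → adj G a b xor (t ∧ adj G v b)) va) (xor-identityʳ _)

adj-*-unlinkedʳ : (G : Graph n) {v b : Fin n} (a : Fin n) → adj G v b ≡ false →
                  adj (G * v) a b ≡ adj G a b
adj-*-unlinkedʳ G {v} {b} a vb = begin
  adj (G * v) a b  ≡⟨ adj-sym (G * v) a b ⟩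
  adj (G * v) b a  ≡⟨ adj-*-unlinkedˡ G a vb ⟩
  adj G b a        ≡⟨ adj-sym G b a ⟩
  adj G a b        ∎
  where open ≡-Reasoning

adj-*-cong : (G H : Graph n) (v a b : Fin n) →
             adj G a b ≡ adj H a b → adj G v a ≡ adj H v a → adj G v b ≡ adj H v b →
             adj (G * v) a b ≡ adj (H * v) a b
adj-*-cong G H v a b ab va vb with a ≟ b
... | yes _ = refl
... | no _  = cong₂ _xor_ ab (cong₂ _∧_ va vb)

-- Row sums over GF(2)

xorSum : ∀ {n} → (Fin n → Bool) → Bool
xorSum {zero}  g = false
xorSum {suc n} g = g zero xor xorSum (g ∘ suc)

foldr-xor-tabulate : ∀ {m k} (g : Fin m → Bool) (f : Fin k → Fin m) →
                     foldr (λ i acc → g i xor acc) false (tabulate f) ≡ xorSum (g ∘ f)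
foldr-xor-tabulate {k = zero}  g f = refl
foldr-xor-tabulate {k = suc k} g f = cong (g (f zero) xor_) (foldr-xor-tabulate g (f ∘ suc))

xorSum-zero : (g : Fin n → Bool) → (∀ i → g i ≡ false) → xorSum g ≡ false
xorSum-zero {zero}  g g≡0 = refl
xorSum-zero {suc n} g g≡0 rewrite g≡0 zero = xorSum-zero (g ∘ suc) (g≡0 ∘ suc)

xorSum-single : (g : Fin n → Bool) (x : Fin n) → (∀ i → i ≢ x → g i ≡ false) → xorSum g ≡ g x
xorSum-single g zero g≡0 = begin
  g zero xor xorSum (g ∘ suc)  ≡⟨ cong (g zero xor_) (xorSum-zero (g ∘ suc) (λ i → g≡0 (suc i) λ ())) ⟩
  g zero xor false             ≡⟨ xor-identityʳ (g zero) ⟩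
  g zero                       ∎
  where open ≡-Reasoning
xorSum-single g (suc x) g≡0 rewrite g≡0 zero (λ ()) =
  xorSum-single (g ∘ suc) x (λ i i≢x → g≡0 (suc i) (i≢x ∘ suc-injective))

xorSum-pair : (g : Fin n → Bool) {x y : Fin n} → x ≢ y →
              (∀ i → i ≢ x → i ≢ y → g i ≡ false) → xorSum g ≡ g x xor g y
xorSum-pair g {zero}  {zero}  x≢y g≡0 = ⊥-elim (x≢y refl)
xorSum-pair g {zero}  {suc y} x≢y g≡0 =
  cong (g zero xor_) (xorSum-single (g ∘ suc) y (λ i i≢y → g≡0 (suc i) (λ ()) (i≢y ∘ suc-injective)))
xorSum-pair g {suc x} {zero}  x≢y g≡0 = begin
  g zero xor xorSum (g ∘ suc)
    ≡⟨ cong (g zero xor_) (xorSum-single (g ∘ suc) x (λ i i≢x → g≡0 (suc i) (i≢x ∘ suc-injective) (λ ()))) ⟩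
  g zero xor g (suc x)         ≡⟨ xor-comm (g zero) (g (suc x)) ⟩
  g (suc x) xor g zero         ∎
  where open ≡-Reasoning
xorSum-pair g {suc x} {suc y} x≢y g≡0 rewrite g≡0 zero (λ ()) (λ ()) =
  xorSum-pair (g ∘ suc) (x≢y ∘ cong suc)
              (λ i i≢x i≢y → g≡0 (suc i) (i≢x ∘ suc-injective) (i≢y ∘ suc-injective))

lookup-∉ : (T : Subset n) {i : Fin n} → ¬ i ∈ T → lookup T i ≡ false
lookup-∉ T {i} i∉T = ¬-not (λ T[i] → i∉T (lookup⇒[]= i T T[i]))

rowSum-pair : (A : Adj n) (T : Subset n) {x y : Fin n} → x ≢ y →
              (∀ {z} → z ∈ T → z ≡ x ⊎ z ≡ y) → (j : Fin n) →
              rowSum A T j ≡ (lookup T x ∧ A x j) xor (lookup T y ∧ A y j)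
rowSum-pair A T x≢y T⊆xy j = trans
  (foldr-xor-tabulate (λ i → lookup T i ∧ A i j) (λ i → i))
  (xorSum-pair _ x≢y λ i i≢x i≢y →
    cong (_∧ A i j) (lookup-∉ T (λ i∈T → [ i≢x , i≢y ]′ (T⊆xy i∈T))))

∣p∣≡2⇒x∈p : {p : Subset n} {x y : Fin n} → (∀ {z} → z ∈ p → z ≡ x ⊎ z ≡ y) →
             ∣ p ∣ ≡ 2 → x ∈ p
∣p∣≡2⇒x∈p {p = p} {x} {y} p⊆xy ∣p∣≡2 with x ∈? p
... | yes x∈p = x∈p
... | no  x∉p = ⊥-elim (<⇒≱ (s≤s (s≤s z≤n)) (subst₂ _≤_ ∣p∣≡2 (∣⁅x⁆∣≡1 y) (p⊆q⇒∣p∣≤∣q∣ p⊆y)))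
  where
  p⊆y : ∀ {z} → z ∈ p → z ∈ ⁅ y ⁆
  p⊆y z∈p with p⊆xy z∈p
  ... | inj₁ refl = ⊥-elim (x∉p z∈p)
  ... | inj₂ refl = x∈⁅x⁆ y

-- Walks inside a vertex set

data Walk (G : Graph n) (P : Subset n) : ℕ → Fin n → Fin n → Set where
  [_]    : ∀ {u} → u ∈ P → Walk G P 0 u u
  _∷⟨_⟩_ : ∀ {k u v w} → u ∈ P → adj G u v ≡ true → Walk G P k v w → Walk G P (suc k) u w

tailVertices : ∀ {G : Graph n} {P k u w} → Walk G P k u w → List (Fin n)
tailVertices [ _ ]                  = []
tailVertices (_∷⟨_⟩_ {v = v} _ _ W) = v ∷ tailVertices W

NonNeighbours : Graph n → Fin n → List (Fin n) → Set
NonNeighbours G v = All (λ t → adj G v t ≡ false)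

lift-walk : (G : Graph n) {P : Subset n} (v : Fin n) {k : ℕ} {u w : Fin n} (W : Walk G P k u w) →
            NonNeighbours G v (tailVertices W) → Walk (G * v) P k u w
lift-walk G v [ u∈P ]              []              = [ u∈P ]
lift-walk G v (u∈P ∷⟨ u~t ⟩ W) (v≁t ∷ v≁rest) =
  u∈P ∷⟨ trans (adj-*-unlinkedʳ G _ v≁t) u~t ⟩ lift-walk G v W v≁rest

last-neighbour : (G : Graph n) {P : Subset n} (v : Fin n) {k : ℕ} {t w : Fin n} (W : Walk G P k t w) →
  NonNeighbours G v (t ∷ tailVertices W) ⊎
  ∃₂ λ k′ z → k′ ≤ k × adj G v z ≡ true ×
              Σ[ W′ ∈ Walk G P k′ z w ] NonNeighbours G v (tailVertices W′)
last-neighbour G v {t = t} [ t∈P ] with adj G v t in v~t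
... | true  = inj₂ (0 , t , z≤n , v~t , [ t∈P ] , [])
... | false = inj₁ (v~t ∷ [])
last-neighbour G v {t = t} (t∈P ∷⟨ t~t′ ⟩ W) with last-neighbour G v W
... | inj₂ (k′ , z , k′≤k , v~z , W′ , v≁W′) = inj₂ (k′ , z , m≤n⇒m≤1+n k′≤k , v~z , W′ , v≁W′)
... | inj₁ v≁W with adj G v t in v~t
...   | true  = inj₂ (_ , t , ≤-refl , v~t , t∈P ∷⟨ t~t′ ⟩ W , v≁W)
...   | false = inj₁ (v~t ∷ v≁W)

-- Attachments and one component

∈∉⇒≢ : {P : Subset n} {u v : Fin n} → u ∈ P → ¬ v ∈ P → u ≢ v
∈∉⇒≢ u∈P v∉P refl = v∉P u∈P

Independent : Bool × Bool → Bool × Bool → Set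
Independent σ τ = σ ≢ (false , false) × τ ≢ (false , false) × σ ≢ τ

spanning-independent : ∀ σ₁ σ₂ σ₃ → proj₁ σ₁ ≡ true → proj₂ σ₂ ≡ true →
                       proj₁ σ₃ xor proj₂ σ₃ ≡ true → Independent σ₁ σ₂ ⊎ Independent σ₁ σ₃
spanning-independent (true , false) (_ , true)     _              refl refl _ = inj₁ ((λ ()) , (λ ()) , λ ())
spanning-independent (true , true)  (false , true) _              refl refl _ = inj₁ ((λ ()) , (λ ()) , λ ())
spanning-independent (true , true)  (true , true)  (true , false) refl refl _ = inj₂ ((λ ()) , (λ ()) , λ ())
spanning-independent (true , true)  (true , true)  (false , true) refl refl _ = inj₂ ((λ ()) , (λ ()) , λ ())
spanning-independent (true , true)  (true , true)  (true , true)  refl refl ()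
spanning-independent (true , true)  (true , true)  (false , false) refl refl ()

_≟₂_ : (σ τ : Bool × Bool) → Dec (σ ≡ τ)
_≟₂_ = ≡-dec Bool._≟_ Bool._≟_

-- An edge h s with its four attachments and the entry x y: (h x , h y , s x , s y , x y).
-- Complementing at h adds the attachment of h to that of s, and flips x y iff h sees both.
EdgeState : Set
EdgeState = Bool × Bool × Bool × Bool × Bool

complement-h : EdgeState → EdgeState
complement-h (hx , hy , sx , sy , xy) = hx , hy , sx xor hx , sy xor hy , xy xor (hx ∧ hy)

swap-ends : EdgeState → EdgeState
swap-ends (hx , hy , sx , sy , xy) = sx , sy , hx , hy , xy

-- true complements at h, false at s.
complement-at : Bool → EdgeState → EdgeState
complement-at true  = complement-h
complement-at false = swap-ends ∘ complement-h ∘ swap-ends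

complement-all : List Bool → EdgeState → EdgeState
complement-all []       σ = σ
complement-all (b ∷ bs) σ = complement-all bs (complement-at b σ)

IsNormal : Bool → EdgeState → Set
IsNormal b₀ (ax , ay , bx , by , xy) = ax ≡ true × ay ≡ false × bx ≡ b₀ × by ≡ true × xy ≡ b₀

Normalisable : EdgeState → Set
Normalisable σ@(_ , _ , _ , _ , xy) =
  ∃ λ bs → IsNormal xy (complement-all bs σ) ⊎ IsNormal xy (swap-ends (complement-all bs σ))

normalisable : ∀ hx hy sx sy xy → Independent (hx , hy) (sx , sy) →
               Normalisable (hx , hy , sx , sy , xy)
normalisable false false _     _     _ (h≢0 , _)       = ⊥-elim (h≢0 refl)
normalisable _     _     false false _ (_ , s≢0 , _)   = ⊥-elim (s≢0 refl)
normalisable false true  false true  _ (_ , _ , h≢s)   = ⊥-elim (h≢s refl)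
normalisable true  false true  false _ (_ , _ , h≢s)   = ⊥-elim (h≢s refl)
normalisable true  true  true  true  _ (_ , _ , h≢s)   = ⊥-elim (h≢s refl)
normalisable false true  true  false false _ = []             , inj₂ (refl , refl , refl , refl , refl)
normalisable false true  true  false true  _ = false ∷ []     , inj₂ (refl , refl , refl , refl , refl)
normalisable false true  true  true  false _ = true ∷ []      , inj₂ (refl , refl , refl , refl , refl)
normalisable false true  true  true  true  _ = true ∷ false ∷ [] , inj₂ (refl , refl , refl , refl , refl)
normalisable true  false false true  false _ = []             , inj₁ (refl , refl , refl , refl , refl)
normalisable true  false false true  true  _ = true ∷ []      , inj₁ (refl , refl , refl , refl , refl)
normalisable true  false true  true  false _ = true ∷ []      , inj₁ (refl , refl , refl , refl , refl)
normalisable true  false true  true  true  _ = []             , inj₁ (refl , refl , refl , refl , refl)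
normalisable true  true  false true  false _ = false ∷ []     , inj₁ (refl , refl , refl , refl , refl)
normalisable true  true  false true  true  _ = false ∷ true ∷ [] , inj₁ (refl , refl , refl , refl , refl)
normalisable true  true  true  false false _ = false ∷ []     , inj₂ (refl , refl , refl , refl , refl)
normalisable true  true  true  false true  _ = []             , inj₂ (refl , refl , refl , refl , refl)

module _ {n} (x y : Fin n) where

  attachment : Graph n → Fin n → Bool × Bool
  attachment G v = adj G v x , adj G v y

  rows-of-rank₂ :
    x ≢ y → (G : Graph n) {P : Subset n} → RankIs G (⁅ x ⁆ ∪ ⁅ y ⁆) P 2 →
    (∃ λ j → j ∈ P × adj G j x ≡ true) × (∃ λ j → j ∈ P × adj G j y ≡ true) ×
    (∃ λ j → j ∈ P × adj G j x xor adj G j y ≡ true)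
  rows-of-rank₂ x≢y G {P} ((S , S⊆ , ∣S∣≡2 , independent) , _) = x-row , y-row , xy-row
    where
    S⊆xy : ∀ {z} → z ∈ S → z ≡ x ⊎ z ≡ y
    S⊆xy z∈S = Sum.map (x∈⁅y⁆⇒x≡y x) (x∈⁅y⁆⇒x≡y y) (x∈p∪q⁻ ⁅ x ⁆ ⁅ y ⁆ (S⊆ z∈S))

    x∈S : x ∈ S
    x∈S = ∣p∣≡2⇒x∈p S⊆xy ∣S∣≡2
    y∈S : y ∈ S
    y∈S = ∣p∣≡2⇒x∈p (Sum.swap ∘ S⊆xy) ∣S∣≡2

    ⁅x⁆⊆S : ∀ {z} → z ∈ ⁅ x ⁆ → z ∈ S
    ⁅x⁆⊆S z∈x rewrite x∈⁅y⁆⇒x≡y x z∈x = x∈S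
    ⁅y⁆⊆S : ∀ {z} → z ∈ ⁅ y ⁆ → z ∈ S
    ⁅y⁆⊆S z∈y rewrite x∈⁅y⁆⇒x≡y y z∈y = y∈S

    row : ∀ T → (∀ {z} → z ∈ T → z ∈ S) → Nonempty T → ∀ {bx by} →
          lookup T x ≡ bx → lookup T y ≡ by →
          ∃ λ j → j ∈ P × (bx ∧ adj G j x) xor (by ∧ adj G j y) ≡ true
    row T T⊆S T≢∅ {bx} {by} Tx Ty with independent T T⊆S T≢∅
    ... | j , j∈P , sum≡1 = j , j∈P , (begin
      (bx ∧ adj G j x) xor (by ∧ adj G j y)
        ≡⟨ cong₂ (λ a b → (bx ∧ a) xor (by ∧ b)) (adj-sym G j x) (adj-sym G j y) ⟩
      (bx ∧ adj G x j) xor (by ∧ adj G y j)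
        ≡⟨ cong₂ (λ a b → (a ∧ adj G x j) xor (b ∧ adj G y j)) Tx Ty ⟨
      (lookup T x ∧ adj G x j) xor (lookup T y ∧ adj G y j)
        ≡⟨ rowSum-pair (adj G) T x≢y (S⊆xy ∘ T⊆S) j ⟨
      rowSum (adj G) T j
        ≡⟨ sum≡1 ⟩
      true ∎)
      where open ≡-Reasoning

    x-row : ∃ λ j → j ∈ P × adj G j x ≡ true
    x-row with row ⁅ x ⁆ ⁅x⁆⊆S (x , x∈⁅x⁆ x) ([]=⇒lookup (x∈⁅x⁆ x))
                   (lookup-∉ ⁅ x ⁆ (x≢y ∘ sym ∘ x∈⁅y⁆⇒x≡y x))
    ... | j , j∈P , e = j , j∈P , trans (sym (xor-identityʳ _)) e

    y-row : ∃ λ j → j ∈ P × adj G j y ≡ true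
    y-row = row ⁅ y ⁆ ⁅y⁆⊆S (y , x∈⁅x⁆ y) (lookup-∉ ⁅ y ⁆ (x≢y ∘ x∈⁅y⁆⇒x≡y y)) ([]=⇒lookup (x∈⁅x⁆ y))

    xy-row : ∃ λ j → j ∈ P × adj G j x xor adj G j y ≡ true
    xy-row = row S (λ z∈S → z∈S) (x , x∈S) ([]=⇒lookup x∈S) ([]=⇒lookup y∈S)

  rank₂⇒independent-attachments :
    x ≢ y → (G : Graph n) {P : Subset n} → RankIs G (⁅ x ⁆ ∪ ⁅ y ⁆) P 2 →
    ∃₂ λ u w → u ∈ P × w ∈ P × Independent (attachment G u) (attachment G w)
  rank₂⇒independent-attachments x≢y G rank
    with rows-of-rank₂ x≢y G rank
  ... | (j₁ , j₁∈P , e₁) , (j₂ , j₂∈P , e₂) , (j₃ , j₃∈P , e₃)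
    with spanning-independent (attachment G j₁) (attachment G j₂) (attachment G j₃) e₁ e₂ e₃
  ... | inj₁ ind = j₁ , j₂ , j₁∈P , j₂∈P , ind
  ... | inj₂ ind = j₁ , j₃ , j₁∈P , j₃∈P , ind

  attachment-* : (G : Graph n) {v : Fin n} → attachment G v ≡ (false , false) →
                 attachment (G * v) ≗ attachment G
  attachment-* G v≡0 t =
    cong₂ _,_ (adj-*-unlinkedʳ G t (cong proj₁ v≡0)) (adj-*-unlinkedʳ G t (cong proj₂ v≡0))

  record IndependentEdge (G : Graph n) (P : Subset n) : Set where
    field
      moves                 : List (Fin n)
      moves⊆P               : All (_∈ P) moves
      moves-keep-attachment : attachment (G ** moves) ≗ attachment G
      h s                   : Fin n
      h∈P                   : h ∈ P
      s∈P                   : s ∈ P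
      h~s                   : adj (G ** moves) h s ≡ true
      independent           : Independent (attachment G h) (attachment G s)

  adjacent⇒independentEdge : (G : Graph n) {P : Subset n} {h s : Fin n} → h ∈ P → s ∈ P → adj G h s ≡ true →
             Independent (attachment G h) (attachment G s) → IndependentEdge G P
  adjacent⇒independentEdge G h∈P s∈P h~s ind = record
    { moves = [] ; moves⊆P = [] ; moves-keep-attachment = λ _ → refl
    ; h∈P = h∈P ; s∈P = s∈P ; h~s = h~s ; independent = ind }

  independentEdge-from-* : (G : Graph n) {P : Subset n} {v : Fin n} → v ∈ P →
                           attachment (G * v) ≗ attachment G → IndependentEdge (G * v) P → IndependentEdge G P
  independentEdge-from-* G {v = v} v∈P keep e = record
    { moves = v ∷ moves ; moves⊆P = v∈P ∷ moves⊆P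
    ; moves-keep-attachment = λ t → trans (moves-keep-attachment t) (keep t)
    ; h∈P = h∈P ; s∈P = s∈P ; h~s = h~s
    ; independent = subst₂ Independent (keep h) (keep s) independent }
    where open IndependentEdge e

  walk⇒independentEdge : ∀ {k u w} → Acc _<_ k → (G : Graph n) {P : Subset n} → Walk G P k u w →
                         Independent (attachment G u) (attachment G w) → IndependentEdge G P
  walk⇒independentEdge _ G [ _ ] (_ , _ , u≢u) = ⊥-elim (u≢u refl)
  walk⇒independentEdge _ G (u∈P ∷⟨ u~w ⟩ [ w∈P ]) ind = adjacent⇒independentEdge G u∈P w∈P u~w ind
  walk⇒independentEdge {u = u} {w} (acc rec) G (_∷⟨_⟩_ {v = v} u∈P u~v (v∈P ∷⟨ v~v₂ ⟩ W₂))
                       ind@(u≢0 , w≢0 , u≢w)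
    with attachment G v ≟₂ (false , false) | attachment G v ≟₂ attachment G u
  ... | no v≢0 | no v≢u = adjacent⇒independentEdge G u∈P v∈P u~v (u≢0 , v≢0 , v≢u ∘ sym)
  ... | no _   | yes v≡u =
    walk⇒independentEdge (rec ≤-refl) G (v∈P ∷⟨ v~v₂ ⟩ W₂)
                         (subst (λ σ → Independent σ (attachment G w)) (sym v≡u) ind)
  ... | yes v≡0 | _ with last-neighbour G v W₂
  ...   | inj₁ (v≁v₂ ∷ _) = ⊥-elim (not-¬ v≁v₂ v~v₂)
  ...   | inj₂ (k′ , z , k′≤k , v~z , W′ , v≁W′) with z ≟ u
  ...     | yes refl = walk⇒independentEdge (rec (s≤s (m≤n⇒m≤1+n k′≤k))) G W′ ind
  ...     | no z≢u with adj G u z in u~z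
  ...       | true  = walk⇒independentEdge (rec (s≤s (s≤s k′≤k))) G (u∈P ∷⟨ u~z ⟩ W′) ind
  ...       | false = independentEdge-from-* G v∈P keep
      (walk⇒independentEdge (rec (s≤s (s≤s k′≤k))) (G * v) (u∈P ∷⟨ u~*z ⟩ lift-walk G v W′ v≁W′)
        (subst₂ Independent (sym (keep u)) (sym (keep _)) ind))
    where
    keep : attachment (G * v) ≗ attachment G
    keep = attachment-* G v≡0
    u~*z : adj (G * v) u z ≡ true
    u~*z = trans (adj-* G v (z≢u ∘ sym)) (cong₂ _xor_ u~z (cong₂ _∧_ (trans (adj-sym G v u) u~v) v~z))

  edgeState : Graph n → Fin n → Fin n → EdgeState
  edgeState H a b = adj H a x , adj H a y , adj H b x , adj H b y , adj H x y

  edgeState-*h : x ≢ y → (H : Graph n) {h s : Fin n} → s ≢ x → s ≢ y → adj H h s ≡ true →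
                 edgeState (H * h) h s ≡ complement-h (edgeState H h s)
  edgeState-*h x≢y H {h} {s} s≢x s≢y h~s =
    cong₂ _,_ (adj-*-unlinkedˡ H x (irrefl H h)) (cong₂ _,_ (adj-*-unlinkedˡ H y (irrefl H h))
    (cong₂ _,_ (seen s≢x) (cong₂ _,_ (seen s≢y) (adj-* H h x≢y))))
    where
    seen : ∀ {t} → s ≢ t → adj (H * h) s t ≡ adj H s t xor adj H h t
    seen {t} s≢t = trans (adj-* H h s≢t) (cong (λ b → adj H s t xor (b ∧ adj H h t)) h~s)

  pick : Fin n → Fin n → Bool → Fin n
  pick h s true  = h
  pick h s false = s

  module _ (x≢y : x ≢ y) {h s : Fin n} (h≢x : h ≢ x) (h≢y : h ≢ y) (s≢x : s ≢ x) (s≢y : s ≢ y) where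

    edgeState-* : (H : Graph n) (b : Bool) → adj H h s ≡ true →
                  edgeState (H * pick h s b) h s ≡ complement-at b (edgeState H h s) ×
                  adj (H * pick h s b) h s ≡ true
    edgeState-* H true  h~s = edgeState-*h x≢y H s≢x s≢y h~s , trans (adj-*-unlinkedˡ H s (irrefl H h)) h~s
    edgeState-* H false h~s =
      cong swap-ends (edgeState-*h x≢y H h≢x h≢y (trans (adj-sym H s h) h~s)) ,
      trans (adj-*-unlinkedʳ H h (irrefl H s)) h~s

    edgeState-** : (H : Graph n) (bs : List Bool) → adj H h s ≡ true →
                   edgeState (H ** map (pick h s) bs) h s ≡ complement-all bs (edgeState H h s) ×
                   adj (H ** map (pick h s) bs) h s ≡ true
    edgeState-** H []       h~s = refl , h~s
    edgeState-** H (b ∷ bs) h~s with edgeState-* H b h~s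
    ... | first , h~s′ with edgeState-** (H * pick h s b) bs h~s′
    ...   | rest , h~s″ = trans rest (cong (complement-all bs) first) , h~s″

  record NormalPair (H : Graph n) (b₀ : Bool) (a b : Fin n) : Set where
    field
      a~x : adj H a x ≡ true
      a≁y : adj H a y ≡ false
      b-x : adj H b x ≡ b₀
      b~y : adj H b y ≡ true
      a~b : adj H a b ≡ true

  record NormalForm (G : Graph n) (P : Subset n) : Set where
    field
      moves         : List (Fin n)
      moves⊆P       : All (_∈ P) moves
      a b           : Fin n
      a∈P           : a ∈ P
      b∈P           : b ∈ P
      normal        : NormalPair (G ** moves) (adj G x y) a b
      moves-keep-xy : adj (G ** moves) x y ≡ adj G x y

  normalPair : (H : Graph n) {b₀ : Bool} {a b : Fin n} → IsNormal b₀ (edgeState H a b) →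
               adj H a b ≡ true → NormalPair H b₀ a b × adj H x y ≡ b₀
  normalPair H (a~x , a≁y , b-x , b~y , x-y) a~b =
    record { a~x = a~x ; a≁y = a≁y ; b-x = b-x ; b~y = b~y ; a~b = a~b } , x-y

  normalise-edge : x ≢ y → (H : Graph n) {P : Subset n} {h s : Fin n} → ¬ x ∈ P → ¬ y ∈ P →
                   h ∈ P → s ∈ P → adj H h s ≡ true →
                   Independent (attachment H h) (attachment H s) → NormalForm H P
  normalise-edge x≢y H {P} {h} {s} x∉P y∉P h∈P s∈P h~s ind
    with normalisable (adj H h x) (adj H h y) (adj H s x) (adj H s y) (adj H x y) ind
  ... | bs , normal
    with edgeState-** x≢y (∈∉⇒≢ h∈P x∉P) (∈∉⇒≢ h∈P y∉P) (∈∉⇒≢ s∈P x∉P) (∈∉⇒≢ s∈P y∉P) H bs h~s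
  ... | state≡ , h~s′ =
    [ with-ends h s h∈P s∈P h~s′ ∘ subst (IsNormal _) (sym state≡)
    , with-ends s h s∈P h∈P (trans (adj-sym H′ s h) h~s′) ∘ subst (IsNormal _) (sym (cong swap-ends state≡))
    ]′ normal
    where
    H′ : Graph n
    H′ = H ** map (pick h s) bs

    pick∈P : ∀ b → pick h s b ∈ P
    pick∈P true  = h∈P
    pick∈P false = s∈P

    with-ends : ∀ a b → a ∈ P → b ∈ P → adj H′ a b ≡ true →
                IsNormal (adj H x y) (edgeState H′ a b) → NormalForm H P
    with-ends a b a∈P b∈P a~b isNormal = record
      { moves = map (pick h s) bs ; moves⊆P = map⁺ (universal pick∈P bs)
      ; a∈P = a∈P ; b∈P = b∈P
      ; normal = proj₁ (normalPair H′ isNormal a~b) ; moves-keep-xy = proj₂ (normalPair H′ isNormal a~b) }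

  edge⇒normalForm : x ≢ y → (G : Graph n) {P : Subset n} → ¬ x ∈ P → ¬ y ∈ P →
                    IndependentEdge G P → NormalForm G P
  edge⇒normalForm x≢y G {P} x∉P y∉P e = record
    { moves = moves ++ NormalForm.moves nf ; moves⊆P = ++⁺ moves⊆P (NormalForm.moves⊆P nf)
    ; a∈P = NormalForm.a∈P nf ; b∈P = NormalForm.b∈P nf
    ; normal = subst₂ (λ K b₀ → NormalPair K b₀ (NormalForm.a nf) (NormalForm.b nf))
                      (sym (**-++ G moves (NormalForm.moves nf))) xy-kept (NormalForm.normal nf)
    ; moves-keep-xy = trans (cong (λ K → adj K x y) (**-++ G moves (NormalForm.moves nf)))
                            (trans (NormalForm.moves-keep-xy nf) xy-kept) }
    where
    open IndependentEdge e
    nf : NormalForm (G ** moves) P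
    nf = normalise-edge x≢y (G ** moves) x∉P y∉P h∈P s∈P h~s
           (subst₂ Independent (sym (moves-keep-attachment h)) (sym (moves-keep-attachment s)) independent)
    xy-kept : adj (G ** moves) x y ≡ adj G x y
    xy-kept = cong proj₂ (moves-keep-attachment x)

  component-normalForm : x ≢ y → (G : Graph n) {P : Subset n} → ¬ x ∈ P → ¬ y ∈ P →
                         (∀ {u w} → u ∈ P → w ∈ P → ∃ λ k → Walk G P k u w) →
                         RankIs G (⁅ x ⁆ ∪ ⁅ y ⁆) P 2 → NormalForm G P
  component-normalForm x≢y G x∉P y∉P connected rank
    with rank₂⇒independent-attachments x≢y G rank
  ... | u , w , u∈P , w∈P , ind with connected u∈P w∈P
  ...   | k , W = edge⇒normalForm x≢y G x∉P y∉P (walk⇒independentEdge (<-wellFounded k) G W ind)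

-- Combining the components

Separated : ∀ {c} → (Fin c → Subset n) → Graph n → Set
Separated F H = ∀ {i j u w} → i ≢ j → u ∈ F i → w ∈ F j → adj H u w ≡ false

RowsAgree : Subset n → Graph n → Graph n → Set
RowsAgree P H K = ∀ {u} w → u ∈ P → adj H u w ≡ adj K u w

module _ {c} {F : Fin c → Subset n} where

  separated-* : {H : Graph n} {k : Fin c} {v : Fin n} → Separated F H → v ∈ F k → Separated F (H * v)
  separated-* {H} {k} sep v∈F {i} {j} {u} {w} i≢j u∈F w∈F with k ≟ i
  ... | yes refl = trans (adj-*-unlinkedʳ H u (sep i≢j v∈F w∈F)) (sep i≢j u∈F w∈F)
  ... | no  k≢i  = trans (adj-*-unlinkedˡ H w (sep k≢i v∈F u∈F)) (sep i≢j u∈F w∈F)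

  separated-** : {H : Graph n} {k : Fin c} {L : List (Fin n)} → Separated F H → All (_∈ F k) L →
                 Separated F (H ** L)
  separated-** sep []           = sep
  separated-** {H} {k} sep (v∈F ∷ L⊆F) = separated-** {k = k} (separated-* {H} {k} sep v∈F) L⊆F

  rows-** : {H : Graph n} {k i : Fin c} {L : List (Fin n)} → Separated F H → All (_∈ F k) L →
            k ≢ i → RowsAgree (F i) (H ** L) H
  rows-**         sep []           k≢i w u∈F = refl
  rows-** {H = H} {k} sep (v∈F ∷ L⊆F) k≢i w u∈F =
    trans (rows-** {k = k} (separated-* {H} {k} sep v∈F) L⊆F k≢i w u∈F)
          (adj-*-unlinkedˡ H w (sep k≢i v∈F u∈F))

agree-** : {P : Subset n} {H K : Graph n} {p q : Fin n} {L : List (Fin n)} →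
           RowsAgree P H K → adj H p q ≡ adj K p q → All (_∈ P) L →
           RowsAgree P (H ** L) (K ** L) × adj (H ** L) p q ≡ adj (K ** L) p q
agree-** agree pq []                    = agree , pq
agree-** {H = H} {K} {p} {q} agree pq (_∷_ {x = v} v∈P L⊆P) =
  agree-** (λ w u∈P → adj-*-cong H K v _ w (agree w u∈P) (agree _ v∈P) (agree w v∈P))
           (adj-*-cong H K v p q pq (agree p v∈P) (agree q v∈P)) L⊆P

module Assembly {c} (x y : Fin n) (G : Graph n) (F : Fin c → Subset n)
                (nf : ∀ i → NormalForm x y G (F i)) where

  movesOf : Fin c → List (Fin n)
  movesOf i = NormalForm.moves (nf i)

  movesOf⊆F : ∀ i → All (_∈ F i) (movesOf i)
  movesOf⊆F i = NormalForm.moves⊆P (nf i)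

  allMoves : List (Fin c) → List (Fin n)
  allMoves = concatMap movesOf

  untouched : {H : Graph n} {j : Fin c} (ks : List (Fin c)) → Separated F H → All (j ≢_) ks →
              RowsAgree (F j) (H ** allMoves ks) H
  untouched []       sep []           w u∈F = refl
  untouched {H} (k ∷ ks) sep (j≢k ∷ j≢ks) w u∈F rewrite **-++ H (movesOf k) (allMoves ks) =
    trans (untouched ks (separated-** {k = k} sep (movesOf⊆F k)) j≢ks w u∈F)
          (rows-** {k = k} sep (movesOf⊆F k) (j≢k ∘ sym) w u∈F)

  rowsAgree-after : {H : Graph n} (k : Fin c) {js : List (Fin c)} → Separated F H → All (k ≢_) js →
                    All (λ j → RowsAgree (F j) H G) js → All (λ j → RowsAgree (F j) (H ** movesOf k) G) js
  rowsAgree-after k sep []           []                = []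
  rowsAgree-after k sep (k≢j ∷ k≢js) (agree ∷ agrees) =
    (λ w u∈F → trans (rows-** {k = k} sep (movesOf⊆F k) k≢j w u∈F) (agree w u∈F)) ∷
    rowsAgree-after k sep k≢js agrees

  Assembled : List (Fin c) → Graph n → Set
  Assembled ks K = Separated F K × adj K x y ≡ adj G x y ×
                   All (λ i → RowsAgree (F i) K (G ** movesOf i)) ks

  assemble : {H : Graph n} (ks : List (Fin c)) → Unique ks → Separated F H →
             adj H x y ≡ adj G x y → All (λ j → RowsAgree (F j) H G) ks →
             Assembled ks (H ** allMoves ks)
  assemble []       _                    sep xy _                     = sep , xy , []
  assemble {H} (k ∷ ks) (k≢ks ∷ unique) sep xy (agree-k ∷ agree-ks)
    rewrite **-++ H (movesOf k) (allMoves ks)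
    with agree-** agree-k xy (movesOf⊆F k)
  ... | agree₁ , xy₁
    with assemble ks unique (separated-** {k = k} sep (movesOf⊆F k))
                  (trans xy₁ (NormalForm.moves-keep-xy (nf k)))
                  (rowsAgree-after k sep k≢ks agree-ks)
  ...   | sep′ , xy′ , agree′ =
    sep′ , xy′ ,
    (λ w u∈F → trans (untouched {j = k} ks (separated-** {k = k} sep (movesOf⊆F k)) k≢ks w u∈F)
                     (agree₁ w u∈F)) ∷ agree′

-- K_c ⊕ K_c from two complementations

KK-irrefl : ∀ {c} (a : Bool × Fin c) → KK c a a ≡ false
KK-irrefl (α , i) with i ≟ i
... | no i≢i = ⊥-elim (i≢i refl)
KK-irrefl (false , i) | yes _ = refl
KK-irrefl (true  , i) | yes _ = refl

KK-xor : ∀ {c} (α β : Bool) {i j : Fin c} → (α , i) ≢ (β , j) →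
         KK c (α , i) (β , j) ≡ ((α xor β) ∧ ⌊ i ≟ j ⌋) xor not (α xor β)
KK-xor α β {i} {j} ne with i ≟ j
KK-xor false false ne | yes refl = ⊥-elim (ne refl)
KK-xor false true  ne | yes refl = refl
KK-xor true  false ne | yes refl = refl
KK-xor true  true  ne | yes refl = ⊥-elim (ne refl)
KK-xor false false ne | no _ = refl
KK-xor false true  ne | no _ = refl
KK-xor true  false ne | no _ = refl
KK-xor true  true  ne | no _ = refl

complementary-products : ∀ α β t →
  ((α xor t) ∧ (β xor t)) xor ((α xor not t) ∧ (β xor not t)) ≡ not (α xor β)
complementary-products false false false = refl
complementary-products false false true  = refl
complementary-products false true  false = refl
complementary-products false true  true  = refl
complementary-products true  false false = refl
complementary-products true  false true  = refl
complementary-products true  true  false = refl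
complementary-products true  true  true  = refl

adj-*-* : (H : Graph n) (p q : Fin n) {u w : Fin n} → u ≢ w →
          adj (H * p * q) u w ≡
          (adj H u w xor (adj H p u ∧ adj H p w)) xor (adj (H * p) q u ∧ adj (H * p) q w)
adj-*-* H p q {u} {w} u≢w =
  trans (adj-* (H * p) q u≢w) (cong (_xor (adj (H * p) q u ∧ adj (H * p) q w)) (adj-* H p u≢w))

-- p sees exactly one side and, once p is complemented, q sees exactly the other side; so the
-- two complementations flip exactly the pairs on the same side (equal α).
KK-by-two-complementations :
  ∀ {c} (H : Graph n) (p q : Fin n) (t : Bool) (g : Bool × Fin c → Fin n) → Injective _≡_ _≡_ g →
  (∀ α i → adj H p (g (α , i)) ≡ α xor t) →
  (∀ α i → adj (H * p) q (g (α , i)) ≡ α xor not t) →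
  (∀ α i β j → g (α , i) ≢ g (β , j) → adj H (g (α , i)) (g (β , j)) ≡ (α xor β) ∧ ⌊ i ≟ j ⌋) →
  ∀ a b → KK c a b ≡ adj (H * p * q) (g a) (g b)
KK-by-two-complementations {n} {c} H p q t g g-inj p-side q-side matching a@(α , i) b@(β , j) =
  by-distinctness (g a ≟ g b)
  where
  open ≡-Reasoning
  u w : Fin n
  u = g a
  w = g b

  by-distinctness : Dec (u ≡ w) → KK c a b ≡ adj (H * p * q) u w
  by-distinctness (yes u≡w) =
    subst (λ b → KK c a b ≡ adj (H * p * q) u (g b)) (g-inj u≡w)
          (trans (KK-irrefl a) (sym (irrefl (H * p * q) u)))
  by-distinctness (no u≢w) = begin
    KK c a b
      ≡⟨ KK-xor α β (u≢w ∘ cong g) ⟩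
    ((α xor β) ∧ ⌊ i ≟ j ⌋) xor not (α xor β)
      ≡⟨ cong₂ _xor_ (matching α i β j u≢w) (complementary-products α β t) ⟨
    adj H u w xor (((α xor t) ∧ (β xor t)) xor ((α xor not t) ∧ (β xor not t)))
      ≡⟨ xor-assoc (adj H u w) _ _ ⟨
    (adj H u w xor ((α xor t) ∧ (β xor t))) xor ((α xor not t) ∧ (β xor not t))
      ≡⟨ cong₂ (λ c d → (adj H u w xor c) xor d)
               (cong₂ _∧_ (p-side α i) (p-side β j)) (cong₂ _∧_ (q-side α i) (q-side β j)) ⟨
    (adj H u w xor (adj H p u ∧ adj H p w)) xor (adj (H * p) q u ∧ adj (H * p) q w)
      ≡⟨ adj-*-* H p q u≢w ⟨
    adj (H * p * q) u w ∎

module _ {c} {G : Graph n} {x y : Fin n} {F : Fin c → Subset n} (x≢y : x ≢ y)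
         (disjoint : ∀ {i j u} → u ∈ F i → u ∈ F j → i ≡ j)
         (x∉F : ∀ i → ¬ x ∈ F i) (y∉F : ∀ i → ¬ y ∈ F i) (separated : Separated F G)
         (nf : ∀ i → NormalForm x y G (F i)) where

  open Assembly x y G F nf

  private
    b₀ : Bool
    b₀ = adj G x y

    Ac : Graph n
    Ac = G ** allMoves (allFin c)

    assembled : Assembled (allFin c) Ac
    assembled = assemble (allFin c) (allFin⁺ c) separated refl (universal (λ _ {_} _ _ → refl) (allFin c))

    Ac-separated : Separated F Ac
    Ac-separated = proj₁ assembled

    Ac-xy : adj Ac x y ≡ b₀
    Ac-xy = proj₁ (proj₂ assembled)

    a b : Fin c → Fin n
    a i = NormalForm.a (nf i)
    b i = NormalForm.b (nf i)

    normal : ∀ i → NormalPair x y Ac b₀ (a i) (b i)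
    normal i = record
      { a~x = trans (agree x a∈P) a~x ; a≁y = trans (agree y a∈P) a≁y ; b-x = trans (agree x b∈P) b-x
      ; b~y = trans (agree y b∈P) b~y ; a~b = trans (agree (b i) a∈P) a~b }
      where
      open NormalForm (nf i) using (a∈P; b∈P)
      open NormalPair (NormalForm.normal (nf i))
      agree : RowsAgree (F i) Ac (G ** movesOf i)
      agree = All.lookup (proj₂ (proj₂ assembled)) (∈-allFin i)

    vertex : Bool × Fin c → Fin n
    vertex (false , i) = a i
    vertex (true  , i) = b i

    vertex∈F : ∀ α i → vertex (α , i) ∈ F i
    vertex∈F false i = NormalForm.a∈P (nf i)
    vertex∈F true  i = NormalForm.b∈P (nf i)

    a≢b : ∀ i → a i ≢ b i
    a≢b i a≡b = not-¬ (irrefl Ac (a i)) (trans (cong (adj Ac (a i)) a≡b) (NormalPair.a~b (normal i)))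

    vertex-injective : Injective _≡_ _≡_ vertex
    vertex-injective {α , i} {β , j} v≡v
      with disjoint (vertex∈F α i) (subst (_∈ F j) (sym v≡v) (vertex∈F β j))
    vertex-injective {false , i} {false , .i} v≡v | refl = refl
    vertex-injective {true  , i} {true  , .i} v≡v | refl = refl
    vertex-injective {false , i} {true  , .i} v≡v | refl = ⊥-elim (a≢b i v≡v)
    vertex-injective {true  , i} {false , .i} v≡v | refl = ⊥-elim (a≢b i (sym v≡v))

    matching : ∀ α i β j → vertex (α , i) ≢ vertex (β , j) →
               adj Ac (vertex (α , i)) (vertex (β , j)) ≡ (α xor β) ∧ ⌊ i ≟ j ⌋
    matching α i β j v≢v with i ≟ j
    ... | no i≢j = trans (Ac-separated i≢j (vertex∈F α i) (vertex∈F β j)) (sym (∧-zeroʳ (α xor β)))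
    matching false i false .i v≢v | yes refl = ⊥-elim (v≢v refl)
    matching true  i true  .i v≢v | yes refl = ⊥-elim (v≢v refl)
    matching false i true  .i v≢v | yes refl = NormalPair.a~b (normal i)
    matching true  i false .i v≢v | yes refl = trans (adj-sym Ac (b i) (a i)) (NormalPair.a~b (normal i))

    y-entry : ∀ α i → adj Ac y (vertex (α , i)) ≡ α
    y-entry false i = trans (adj-sym Ac y (a i)) (NormalPair.a≁y (normal i))
    y-entry true  i = trans (adj-sym Ac y (b i)) (NormalPair.b~y (normal i))

    x-entry : ∀ {β} → b₀ ≡ β → ∀ α i → adj Ac x (vertex (α , i)) ≡ (if α then β else true)
    x-entry b₀≡β false i = trans (adj-sym Ac x (a i)) (NormalPair.a~x (normal i))
    x-entry b₀≡β true  i = trans (adj-sym Ac x (b i)) (trans (NormalPair.b-x (normal i)) b₀≡β)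

    ≢vertex : ∀ {z} → (∀ i → ¬ z ∈ F i) → ∀ α i → z ≢ vertex (α , i)
    ≢vertex z∉F α i = ∈∉⇒≢ (vertex∈F α i) (z∉F i) ∘ sym

    Complementations : Set
    Complementations = ∃₂ λ p q → ∃ λ t →
      (∀ α i → adj Ac p (vertex (α , i)) ≡ α xor t) ×
      (∀ α i → adj (Ac * p) q (vertex (α , i)) ≡ α xor not t)

    complementations : ∀ β → b₀ ≡ β → Complementations
    complementations false b₀≡0 = x , y , true , x-side , y-side
      where
      x-side : ∀ α i → adj Ac x (vertex (α , i)) ≡ α xor true
      x-side false = x-entry b₀≡0 false
      x-side true  = x-entry b₀≡0 true
      y-side : ∀ α i → adj (Ac * x) y (vertex (α , i)) ≡ α xor false
      y-side α i = begin
        adj (Ac * x) y u                         ≡⟨ adj-* Ac x (≢vertex y∉F α i) ⟩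
        adj Ac y u xor (adj Ac x y ∧ adj Ac x u)
          ≡⟨ cong₂ _xor_ (y-entry α i) (cong (_∧ adj Ac x u) (trans Ac-xy b₀≡0)) ⟩
        α xor false                              ∎
        where
        open ≡-Reasoning
        u : Fin n
        u = vertex (α , i)
    complementations true b₀≡1 = y , x , false , y-side , x-side
      where
      y-side : ∀ α i → adj Ac y (vertex (α , i)) ≡ α xor false
      y-side α i = trans (y-entry α i) (sym (xor-identityʳ α))
      x-all : ∀ α i → adj Ac x (vertex (α , i)) ≡ true
      x-all false = x-entry b₀≡1 false
      x-all true  = x-entry b₀≡1 true
      x-side : ∀ α i → adj (Ac * y) x (vertex (α , i)) ≡ α xor true
      x-side α i = begin
        adj (Ac * y) x u                         ≡⟨ adj-* Ac y (≢vertex x∉F α i) ⟩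
        adj Ac x u xor (adj Ac y x ∧ adj Ac y u)
          ≡⟨ cong₂ _xor_ (x-all α i) (cong₂ _∧_ (trans (adj-sym Ac y x) (trans Ac-xy b₀≡1)) (y-entry α i)) ⟩
        true xor (true ∧ α)                      ≡⟨ xor-comm true α ⟩
        α xor true                               ∎
        where
        open ≡-Reasoning
        u : Fin n
        u = vertex (α , i)

  normalForms⇒KK-minor : HasVertexMinorIso G (KK c)
  normalForms⇒KK-minor with complementations b₀ refl
  ... | p , q , t , p-side , q-side =
    allMoves (allFin c) ++ p ∷ q ∷ [] , vertex , vertex-injective , λ u v →
      trans (KK-by-two-complementations Ac p q t vertex vertex-injective p-side q-side matching u v)
            (cong (λ A → A (vertex u) (vertex v))
                  (trans (cong adj (sym (**-++ G (allMoves (allFin c)) (p ∷ q ∷ []))))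
                         (adj-** G (allMoves (allFin c) ++ p ∷ q ∷ []))))

ConnAvoid-start : {G : Graph n} {x y u w : Fin n} → ConnAvoid G x y u w → u ≢ x × u ≢ y
ConnAvoid-start (here u≢x u≢y)       = u≢x , u≢y
ConnAvoid-start (step u≢x u≢y _ _) = u≢x , u≢y

ConnAvoid⇒Walk : {G : Graph n} {x y : Fin n} {P : Subset n} →
                 (∀ {u w} → u ∈ P → ConnAvoid G x y u w → w ∈ P) →
                 ∀ {u w} → u ∈ P → ConnAvoid G x y u w → ∃ λ k → Walk G P k u w
ConnAvoid⇒Walk closed u∈P (here _ _) = 0 , [ u∈P ]
ConnAvoid⇒Walk {P = P} closed u∈P (step {v = v} u≢x u≢y u~v rest) =
  let k , W = ConnAvoid⇒Walk closed v∈P rest in suc k , u∈P ∷⟨ u~v ⟩ W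
  where
  v∈P : v ∈ P
  v∈P = closed u∈P (step u≢x u≢y u~v (here (proj₁ (ConnAvoid-start rest)) (proj₂ (ConnAvoid-start rest))))

module Components {c} {G : Graph n} {x y : Fin n} {F : Fin c → Subset n}
                  (components : IsComponents G x y F) where

  disjoint : ∀ {i j u} → u ∈ F i → u ∈ F j → i ≡ j
  disjoint = proj₁ (proj₂ components) _ _ _

  x∉F : ∀ i → ¬ x ∈ F i
  x∉F i = proj₁ (proj₁ (proj₂ (proj₂ components)) i)

  y∉F : ∀ i → ¬ y ∈ F i
  y∉F i = proj₂ (proj₁ (proj₂ (proj₂ components)) i)

  closed : ∀ i {u w} → u ∈ F i → ConnAvoid G x y u w → w ∈ F i
  closed i u∈F = proj₂ (proj₂ (proj₂ (proj₂ (proj₂ components))) i _ _ u∈F)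

  walks : ∀ i {u w} → u ∈ F i → w ∈ F i → ∃ λ k → Walk G (F i) k u w
  walks i u∈F w∈F =
    ConnAvoid⇒Walk (closed i) u∈F (proj₁ (proj₂ (proj₂ (proj₂ (proj₂ components))) i _ _ u∈F) w∈F)

  separated : Separated F G
  separated {i} {j} i≢j u∈F w∈F = ¬-not λ u~w →
    i≢j (disjoint (closed i u∈F (step (∈∉⇒≢ u∈F (x∉F i)) (∈∉⇒≢ u∈F (y∉F i)) u~w
                                      (here (∈∉⇒≢ w∈F (x∉F j)) (∈∉⇒≢ w∈F (y∉F j)))))
                  w∈F)

lemma7p7 : ∀ {n} (G : Graph n) (x y : Fin n) → x ≢ y →
    (c : ℕ) (F : Fin c → Subset n) → IsComponents G x y F →
    (∀ i → RankIs G (⁅ x ⁆ ∪ ⁅ y ⁆) (F i) 2) →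
    HasVertexMinorIso G (KK c)
lemma7p7 G x y x≢y c F components rank =
  normalForms⇒KK-minor x≢y disjoint x∉F y∉F separated
    (λ i → component-normalForm x y x≢y G (x∉F i) (y∉F i) (walks i) (rank i))
  where open Components components
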